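{- For every $\gamma\in(\mathbb{Z}/N\mathbb{Z})^\times$, one has $\tilde\delta_\gamma(\mathfrak{dmr}_0^{[N]})\subset\mathfrak{dmr}_0^{[N]}$ and $\delta_\gamma(\mathfrak{dmr}_0^{\mu_N})\subset\mathfrak{dmr}_0^{\mu_N}$.
   Context: Let $N\ge3$, $\mu_N$ the $N$-th roots of unity in $\mathbb{C}$, $\iota:\{1,\dots,N\}\to\mathbb{Z}/N\mathbb{Z}$ the residue bijection. $\mathbb{Q}\langle\langle L\rangle\rangle$ is the algebra of noncommutative formal power series over an alphabet $L$, $(\psi\mid w)$ the coefficient of the word $w$. Alphabets $X=\{x_0\}\cup\{x_\zeta:\zeta\in\mu_N\}$, $Y=\{y_{k,\zeta}:k\ge1,\zeta\in\mu_N\}$, $\widetilde X=\{\tilde x\}\cup\{\tilde x_\alpha:\alpha\in\mathbb{Z}/N\mathbb{Z}\}$, $\widetilde Y=\{\tilde y_{k,\alpha}\}$, with embeddings $y_{k,\zeta}\mapsto x_0^{k-1}x_\zeta$, $\tilde y_{k,\alpha}\mapsto\tilde x^{k-1}\tilde x_\alpha$, decompositions $\mathbb{Q}\langle\langle X\rangle\rangle=\mathbb{Q}\langle\langle Y\rangle\rangle\oplus\mathbb{Q}\langle\langle X\rangle\rangle x_0$, $\mathbb{Q}\langle\langle \widetilde X\rangle\rangle=\mathbb{Q}\langle\langle \widetilde Y\rangle\rangle\oplus\mathbb{Q}\langle\langle \widetilde X\rangle\rangle\tilde x$, projections $\pi_Y,\pi_{\widetilde Y}$ onto first summands. Coproducts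 (continuous algebra morphisms): $\widehat\Delta_{\sqcup\!\sqcup}$, $\widehat\Delta_{\tilde{\sqcup\!\sqcup}}$ make all letters primitive; $\widehat\Delta_*(y_{k,\zeta})=y_{k,\zeta}\otimes1+1\otimes y_{k,\zeta}+\sum_{k_1+k_2=k,\,k_i\ge1,\,\zeta_1\zeta_2=\zeta}y_{k_1,\zeta_1}\otimes y_{k_2,\zeta_2}$; $\widehat\Delta_{\tilde*}(\tilde y_{k,\alpha})=\tilde y_{k,\alpha}\otimes1+1\otimes\tilde y_{k,\alpha}+\sum_{k_1+k_2=k,\,k_i\ge1}\tilde y_{k_1,\alpha}\otimes\tilde y_{k_2,\alpha}$. $\mathbf p$: linear automorphism, $x_0^{k_1-1}x_{\zeta_1}\cdots x_0^{k_r-1}x_{\zeta_r}x_0^{k_{r+1}-1}\mapsto x_0^{k_1-1}x_{\zeta_1}x_0^{k_2-1}x_{\zeta_1\zeta_2}\cdots x_0^{k_r-1}x_{\zeta_1\cdots\zeta_r}x_0^{k_{r+1}-1}$. $\widetilde{\mathbf q}$: linear automorphism, $\tilde x^{k_1-1}\tilde x_{\alpha_1}\cdots\tilde x^{k_r-1}\tilde x_{\alpha_r}\tilde x^{k_{r+1}-1}\mapsto\tilde x^{k_1-1}\tilde x_{\alpha_1-\alpha_2}\cdots\tilde x^{k_{r-1}-1}\tilde x_{\alpha_{r-1}-\alpha_r}\tilde x^{k_r-1}\tilde x_{\alpha_r}\tilde x^{k_{r+1}-1}$. $\mathfrak{dmr}_0^{\mu_N}$: the $\psi\in\mathbb{Q}\langle\langle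 X\rangle\rangle$ with (i) $(\psi\mid x_0)=(\psi\mid x_1)=0$; (ii) $\psi$ is $\widehat\Delta_{\sqcup\!\sqcup}$-primitive; (iii) $(\psi\mid x_\zeta)=(\psi\mid x_{\zeta^{ -1}})$ for all $\zeta$; (iv) $\psi_*:=\pi_Y(\mathbf p^{ -1}\psi)+\sum_{n\ge2}\frac{(-1)^{n-1}}{n}(\psi\mid x_0^{n-1}x_1)y_{1,1}^n$ is $\widehat\Delta_*$-primitive. $\mathfrak{dmr}_0^{[N]}$: the $\tilde\psi\in\mathbb{Q}\langle\langle\widetilde X\rangle\rangle$ with (i) $(\tilde\psi\mid\tilde x)=\sum_\alpha(\tilde\psi\mid\tilde x_\alpha)=0$; (ii) $\tilde\psi$ is $\widehat\Delta_{\tilde{\sqcup\!\sqcup}}$-primitive; (iii) $(\tilde\psi\mid\tilde x_\alpha)=(\tilde\psi\mid\tilde x_{ -\alpha})$ for all $\alpha$; (iv) $\tilde\psi_{\tilde*}:=\pi_{\widetilde Y}(\widetilde{\mathbf q}^{ -1}\tilde\psi)+\sum_{n\ge2}\sum_{a,b_1,\dots,b_n=1}^N\frac{(-1)^{n-1}}{nN^{n+1}}(\tilde\psi\mid\tilde x^{n-1}\tilde x_{\iota(a)})\tilde y_{1,\iota(b_1)}\cdots\tilde y_{1,\iota(b_n)}$ is $\widehat\Delta_{\tilde*}$-primitive. For $\gamma\in(\mathbb{Z}/N\mathbb{Z})^\times$: $\delta_\gamma$ is the continuous algebra automorphism of $\mathbb{Q}\langle\langle X\rangle\rangle$ with $x_0\mapsto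 x_0$, $x_\zeta\mapsto x_{\zeta^{\iota^{ -1}(\gamma)}}$; $\tilde\delta_\gamma$ that of $\mathbb{Q}\langle\langle\widetilde X\rangle\rangle$ with $\tilde x\mapsto\tilde x$, $\tilde x_\alpha\mapsto\tilde x_{\gamma\alpha}$. -}

module Defs where

open import Data.Nat as ℕ using (ℕ; zero; suc; NonZero)
open import Data.Nat.DivMod using (_mod_)
open import Data.Fin as Fin using (Fin; toℕ)
open import Data.Fin.Properties as FinP using ()
open import Data.Integer as ℤ using (ℤ; +_)
open import Data.Rational as ℚ using (ℚ; 0ℚ; 1ℚ; _/_)
open import Data.List as List using (List; []; _∷_; _++_; concatMap; map; length; replicate; foldr; allFin)
open import Data.List.Properties as ListP using ()
open import Data.Product using (_×_; _,_; Σ)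
open import Data.Bool using (Bool; true; false; if_then_else_)
open import Relation.Nullary using (yes; no; does)
open import Relation.Binary.Definitions using (DecidableEquality)
open import Relation.Binary.PropositionalEquality using (_≡_; refl; cong)

Word : Set → Set
Word A = List A

-- An element ψ of ℚ⟨⟨A⟩⟩ is given by its coefficients (ψ ∣ w).
Series : Set → Set
Series A = Word A → ℚ

sumℚ : List ℚ → ℚ
sumℚ = foldr ℚ._+_ 0ℚ

δ[_≟_] : {B : Set} → DecidableEquality B → B → B → ℚ
δ[ _≟_ ≟ a ] b = if does (_≟_ a b) then 1ℚ else 0ℚ

module Coproduct {A : Set} (_≟_ : DecidableEquality A)
                 -- Δ on a letter, as a finite sum (with multiplicities,
                 -- all coefficients being 1) of pure tensors u ⊗ v
                 (Δl : A → List (Word A × Word A))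
                 -- finite list of all words w whose image Δ(w) can
                 -- contain u ⊗ v (all words of the right length / weight)
                 (cands : Word A → Word A → List (Word A)) where

  _≟w_ : DecidableEquality (Word A)
  _≟w_ = ListP.≡-dec _≟_

  _≟p_ : DecidableEquality (Word A × Word A)
  (u , v) ≟p (u' , v') with u ≟w u' | v ≟w v'
  ... | yes refl | yes refl = yes refl
  ... | no ne | _ = no λ { refl → ne refl }
  ... | yes _ | no ne = no λ { refl → ne refl }

  Δw : Word A → List (Word A × Word A)
  Δw [] = ([] , []) ∷ []
  Δw (a ∷ w) = concatMap (λ { (p , q) → map (λ { (u , v) → (p ++ u , q ++ v) }) (Δw w) }) (Δl a)

  Δcoeff : Word A → Word A → Word A → ℚ
  Δcoeff w u v = sumℚ (map (δ[ _≟p_ ≟ (u , v) ]) (Δw w))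

  Δ : Series A → Word A → Word A → ℚ
  Δ ψ u v = sumℚ (map (λ w → ψ w ℚ.* Δcoeff w u v) (cands u v))

  prim : Series A → Word A → Word A → ℚ
  prim ψ u v = (δ[ _≟w_ ≟ [] ] v ℚ.* ψ u) ℚ.+ (δ[ _≟w_ ≟ [] ] u ℚ.* ψ v)

  IsPrimitive : Series A → Set
  IsPrimitive ψ = ∀ u v → Δ ψ u v ≡ prim ψ u v

-- Z/NZ (also used as a model of μ_N : the residue a stands for the root
-- of unity exp(2πi a/N); multiplication of roots = addition of residues)

module _ (N : ℕ) .{{_ : NonZero N}} where

  ZN : Set
  ZN = Fin N

  _+N_ : ZN → ZN → ZN
  a +N b = (toℕ a ℕ.+ toℕ b) mod N

  -N_ : ZN → ZN
  -N a = (N ℕ.∸ toℕ a) mod N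

  _-N_ : ZN → ZN → ZN
  a -N b = a +N (-N b)

  _*N_ : ZN → ZN → ZN
  a *N b = (toℕ a ℕ.* toℕ b) mod N

  0N : ZN
  0N = 0 mod N

  1N : ZN
  1N = 1 mod N

  IsUnit : ZN → Set
  IsUnit γ = Σ ZN λ β → γ *N β ≡ 1N

-- X = {x₀} ∪ {x_ζ}, and X̃ = {x̃} ∪ {x̃_α} have the same shape;
-- we use one type for both: for X, the letter x a is x_ζ with
-- ζ = exp(2πi a/N); for X̃, the letter x a is x̃_a and x₀ is x̃.

data XLetter (N : ℕ) : Set where
  x₀ : XLetter N
  x  : Fin N → XLetter N

-- y[1+ j , a ] stands for y_{j+1,ζ} (resp. ỹ_{j+1,a}), so k = j + 1 ≥ 1.
data YLetter (N : ℕ) : Set where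
  y[1+_,_] : ℕ → Fin N → YLetter N

_≟X_ : {N : ℕ} → DecidableEquality (XLetter N)
x₀ ≟X x₀ = yes refl
x₀ ≟X x _ = no λ ()
x _ ≟X x₀ = no λ ()
x a ≟X x b with a Fin.≟ b
... | yes refl = yes refl
... | no ne = no λ { refl → ne refl }

_≟Y_ : {N : ℕ} → DecidableEquality (YLetter N)
y[1+ j , a ] ≟Y y[1+ k , b ] with j ℕ.≟ k | a Fin.≟ b
... | yes refl | yes refl = yes refl
... | no ne | _ = no λ { refl → ne refl }
... | yes _ | no ne = no λ { refl → ne refl }

wordsX : (N : ℕ) → ℕ → List (Word (XLetter N))
wordsX N zero = [] ∷ []
wordsX N (suc n) = concatMap (λ l → map (l ∷_) (wordsX N n)) (x₀ ∷ map x (allFin N))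

weight : {N : ℕ} → Word (YLetter N) → ℕ
weight [] = 0
weight (y[1+ j , _ ] ∷ w) = suc j ℕ.+ weight w

-- all Y-words of weight n (fuel argument f ≥ n)
wordsYfuel : (N : ℕ) → ℕ → ℕ → List (Word (YLetter N))
wordsYfuel N f zero = [] ∷ []
wordsYfuel N zero (suc n) = []
wordsYfuel N (suc f) (suc n) =
  concatMap (λ j → concatMap (λ a → map (y[1+ toℕ j , a ] ∷_) (wordsYfuel N f (n ℕ.∸ toℕ j)))
                             (allFin N))
            (allFin (suc n))

wordsY : (N : ℕ) → ℕ → List (Word (YLetter N))
wordsY N n = wordsYfuel N n n

embed : {N : ℕ} → Word (YLetter N) → Word (XLetter N)
embed [] = []
embed (y[1+ j , a ] ∷ w) = replicate j x₀ ++ (x a ∷ embed w)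

πY : {N : ℕ} → Series (XLetter N) → Series (YLetter N)
πY φ v = φ (embed v)

-- shuffle coproduct: letters primitive (same formula for X and X̃)
Δl-sh : {N : ℕ} → XLetter N → List (Word (XLetter N) × Word (XLetter N))
Δl-sh l = ((l ∷ []) , []) ∷ ([] , (l ∷ [])) ∷ []

module _ (N : ℕ) .{{_ : NonZero N}} where

  IsShPrimitive : Series (XLetter N) → Set
  IsShPrimitive = Coproduct.IsPrimitive _≟X_ Δl-sh (λ u v → wordsX N (length u ℕ.+ length v))

  -- Δ_* on y_{k,ζ}:  Σ_{k₁+k₂=k, ζ₁ζ₂=ζ} y_{k₁,ζ₁} ⊗ y_{k₂,ζ₂}
  Δl-st : YLetter N → List (Word (YLetter N) × Word (YLetter N))
  Δl-st l@(y[1+ zero , a ]) = ((l ∷ []) , []) ∷ ([] , (l ∷ [])) ∷ []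
  Δl-st l@(y[1+ suc m , a ]) =
    ((l ∷ []) , []) ∷ ([] , (l ∷ [])) ∷
    concatMap (λ j → map (λ b → ((y[1+ toℕ j , b ] ∷ []) , (y[1+ m ℕ.∸ toℕ j , _-N_ N a b ] ∷ [])))
                         (allFin N))
              (allFin (suc m))

  -- Δ_{~*} on ỹ_{k,α}:  Σ_{k₁+k₂=k} ỹ_{k₁,α} ⊗ ỹ_{k₂,α}
  Δl-st~ : YLetter N → List (Word (YLetter N) × Word (YLetter N))
  Δl-st~ l@(y[1+ zero , a ]) = ((l ∷ []) , []) ∷ ([] , (l ∷ [])) ∷ []
  Δl-st~ l@(y[1+ suc m , a ]) =
    ((l ∷ []) , []) ∷ ([] , (l ∷ [])) ∷
    map (λ j → ((y[1+ toℕ j , a ] ∷ []) , (y[1+ m ℕ.∸ toℕ j , a ] ∷ [])))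
        (allFin (suc m))

  IsStPrimitive : Series (YLetter N) → Set
  IsStPrimitive = Coproduct.IsPrimitive _≟Y_ Δl-st (λ u v → wordsY N (weight u ℕ.+ weight v))

  IsSt~Primitive : Series (YLetter N) → Set
  IsSt~Primitive = Coproduct.IsPrimitive _≟Y_ Δl-st~ (λ u v → wordsY N (weight u ℕ.+ weight v))

  -- p : x_{ζ₁} … x_{ζ_r} (with x₀'s interspersed) ↦ x_{ζ₁} x_{ζ₁ζ₂} … x_{ζ₁⋯ζ_r}
  pAcc : ZN N → Word (XLetter N) → Word (XLetter N)
  pAcc c [] = []
  pAcc c (x₀ ∷ w) = x₀ ∷ pAcc c w
  pAcc c (x a ∷ w) = x (_+N_ N c a) ∷ pAcc (_+N_ N c a) w

  p : Word (XLetter N) → Word (XLetter N)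
  p = pAcc (0N N)

  nextα : Word (XLetter N) → ZN N
  nextα [] = 0N N
  nextα (x₀ ∷ w) = nextα w
  nextα (x a ∷ w) = a

  -- q̃ : x̃_{α₁} … x̃_{α_r} ↦ x̃_{α₁-α₂} … x̃_{α_{r-1}-α_r} x̃_{α_r}
  q~ : Word (XLetter N) → Word (XLetter N)
  q~ [] = []
  q~ (x₀ ∷ w) = x₀ ∷ q~ w
  q~ (x a ∷ w) = x (_-N_ N a (nextα w)) ∷ q~ w

  -- p⁻¹ and q̃⁻¹ on series: since p permutes words, (p⁻¹ψ ∣ w) = (ψ ∣ p w)
  p⁻¹ : Series (XLetter N) → Series (XLetter N)
  p⁻¹ ψ w = ψ (p w)

  q~⁻¹ : Series (XLetter N) → Series (XLetter N)
  q~⁻¹ ψ w = ψ (q~ w)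

  powℚ : ℚ → ℕ → ℚ
  powℚ q zero = 1ℚ
  powℚ q (suc n) = q ℚ.* powℚ q n

  c : (n : ℕ) → .{{NonZero n}} → ℚ
  c n = powℚ (ℚ.- 1ℚ) (n ℕ.∸ 1) ℚ.* (+ 1 / n)

  _≟YW_ : DecidableEquality (Word (YLetter N))
  _≟YW_ = ListP.≡-dec _≟Y_

  AllK1 : Word (YLetter N) → Bool
  AllK1 [] = true
  AllK1 (y[1+ zero , _ ] ∷ w) = AllK1 w
  AllK1 (y[1+ suc _ , _ ] ∷ w) = false

  -- coefficient at v of Σ_{n≥2} (-1)^{n-1}/n (ψ ∣ x₀^{n-1} x₁) y_{1,1}^n
  corr : Series (XLetter N) → Series (YLetter N)
  corr ψ v with length v
  ... | zero = 0ℚ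
  ... | suc zero = 0ℚ
  ... | n@(suc (suc m)) =
    if does (v ≟YW replicate n y[1+ 0 , 0N N ])
    then c n ℚ.* ψ (replicate (suc m) x₀ ++ (x (0N N) ∷ []))
    else 0ℚ

  -- coefficient at v of
  -- Σ_{n≥2} Σ_{a,b₁..bₙ} (-1)^{n-1}/(n N^{n+1}) (ψ̃ ∣ x̃^{n-1} x̃_{ι(a)}) ỹ_{1,ι(b₁)}⋯ỹ_{1,ι(bₙ)}
  -- (as (b₁,…,bₙ) ranges over {1..N}ⁿ, each word ỹ_{1,β₁}⋯ỹ_{1,βₙ} occurs once)
  corr~ : Series (XLetter N) → Series (YLetter N)
  corr~ ψ v with length v
  ... | zero = 0ℚ
  ... | suc zero = 0ℚ
  ... | n@(suc (suc m)) =
    if AllK1 v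
    then c n ℚ.* powℚ (+ 1 / N) (suc n)
           ℚ.* sumℚ (map (λ a → ψ (replicate (suc m) x₀ ++ (x a ∷ []))) (allFin N))
    else 0ℚ

  ψ* : Series (XLetter N) → Series (YLetter N)
  ψ* ψ v = πY (p⁻¹ ψ) v ℚ.+ corr ψ v

  ψ~* : Series (XLetter N) → Series (YLetter N)
  ψ~* ψ v = πY (q~⁻¹ ψ) v ℚ.+ corr~ ψ v

  record InDmr0μ (ψ : Series (XLetter N)) : Set where
    field
      coeff-x₀ : ψ (x₀ ∷ []) ≡ 0ℚ
      coeff-x₁ : ψ (x (0N N) ∷ []) ≡ 0ℚ
      sh-prim  : IsShPrimitive ψ
      symm     : ∀ a → ψ (x a ∷ []) ≡ ψ (x (-N_ N a) ∷ [])
      st-prim  : IsStPrimitive (ψ* ψ)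

  record InDmr0N (ψ : Series (XLetter N)) : Set where
    field
      coeff-x~ : ψ (x₀ ∷ []) ≡ 0ℚ
      coeff-Σ  : sumℚ (map (λ a → ψ (x a ∷ [])) (allFin N)) ≡ 0ℚ
      sh-prim  : IsShPrimitive ψ
      symm     : ∀ a → ψ (x a ∷ []) ≡ ψ (x (-N_ N a) ∷ [])
      st-prim  : IsSt~Primitive (ψ~* ψ)

-- δ_γ and δ̃_γ : the algebra automorphism induced by x_a ↦ x_{γa}
-- (ζ ↦ ζ^γ for roots of unity, α ↦ γα for residues: same formula).

  δLetter : ZN N → XLetter N → XLetter N
  δLetter γ x₀ = x₀
  δLetter γ (x a) = x (_*N_ N γ a)

  -- (δ_γ ψ ∣ v) = Σ_w (ψ ∣ w) [δ_γ(w) = v]   (δ_γ preserves length)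
  δ : ZN N → Series (XLetter N) → Series (XLetter N)
  δ γ ψ v = sumℚ (map (λ w → ψ w ℚ.* δ[ ListP.≡-dec _≟X_ ≟ v ] (map (δLetter γ) w))
                     (wordsX N (length v)))

-- Let β be the inverse of γ in ℤ/N. Then (δ_γ ψ ∣ w) = (ψ ∣ δ_β w), so it suffices to see that
-- precomposing with the letter relabelling x_a ↦ x_{βa} preserves every defining condition.
-- Multiplication by β is additive and fixes 0, hence the relabelling commutes with p, with q̃
-- and with the embedding of Y-words, and it fixes the correction terms (for the averaged
-- correction of dmr₀^[N] because multiplication by a unit permutes ℤ/N). It also respects each
-- coproduct: the letter coproducts are relabelled termwise, using β(a − b) = βa − βb and a
-- reindexing by the unit for Δ_*, so primitivity is preserved.

module Submission where

open import Defs
open import Data.Nat using (ℕ; NonZero; _≤_)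
open import Data.Product using (_×_)

open import Data.Nat as ℕ using (zero; suc; _∸_; _%_)
import Data.Nat.Properties as ℕₚ
open import Data.Nat.DivMod using (_mod_; %-distribˡ-+; %-distribˡ-*; m%n%n≡m%n; n%n≡0; m*n%n≡0; m<n⇒m%n≡m; m%n<n)
import Data.Integer as ℤ
open import Data.Rational using (ℚ; 0ℚ; 1ℚ; _+_; _*_; _/_)
open import Data.Rational.Properties using (+-identityˡ; +-identityʳ; +-assoc; *-identityʳ; *-zeroʳ; +-0-commutativeMonoid)
open import Data.Fin as Fin using (Fin; toℕ; punchIn)
open import Data.Fin.Properties using (toℕ-fromℕ<; toℕ-injective; toℕ<n; punchInᵢ≢i)
open import Data.Fin.Permutation using (permutation)
open import Data.List using (List; []; _∷_; _++_; concatMap; map; length; replicate; tabulate; allFin)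
open import Data.List.Properties using (≡-dec; map-cong; map-∘; map-id; map-tabulate; map-++; map-replicate; length-map)
import Data.Product as Product
open Product using (_,_)
open import Data.Bool using (if_then_else_)
open import Function using (_∘_; id)
open import Relation.Nullary using (Dec; does)
open import Relation.Nullary.Decidable using (map′; does-≡; dec-true; dec-false)
open import Relation.Binary.Definitions using (DecidableEquality)
open import Relation.Binary.PropositionalEquality
  using (_≡_; _≢_; _≗_; refl; sym; trans; cong; cong₂; setoid; module ≡-Reasoning)
import Relation.Binary.Construct.On as On
open import Algebra.Properties.CommutativeMonoid.Sum +-0-commutativeMonoid
  using (sum; sum-permute; sum-remove; sum-cong-≗; sum-replicate-zero)

module ResidueArithmetic {N : ℕ} .{{_ : NonZero N}} where

  open import Relation.Binary.Reasoning.Setoid (On.setoid (setoid ℕ) (_% N))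

  private
    infix 4 _≈_
    _≈_ : ℕ → ℕ → Set
    m ≈ n = m % N ≡ n % N

    N≈0 : N ≈ 0
    N≈0 = trans (n%n≡0 N) (sym (m*n%n≡0 0 N))

    toℕ-mod : ∀ m → toℕ (m mod N) ≈ m
    toℕ-mod m = trans (cong (_% N) (toℕ-fromℕ< _)) (m%n%n≡m%n m N)

    ≈⇒≡ : ∀ {a b : ZN N} → toℕ a ≈ toℕ b → a ≡ b
    ≈⇒≡ {a} {b} e = toℕ-injective
      (trans (sym (m<n⇒m%n≡m (toℕ<n a))) (trans e (m<n⇒m%n≡m (toℕ<n b))))

    +-cong : ∀ {m m′ n n′} → m ≈ m′ → n ≈ n′ → m ℕ.+ n ≈ m′ ℕ.+ n′
    +-cong {m} {m′} {n} {n′} e f =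
      trans (%-distribˡ-+ m n N) (trans (cong₂ (λ i j → (i ℕ.+ j) % N) e f) (sym (%-distribˡ-+ m′ n′ N)))

    *-cong : ∀ {m m′ n n′} → m ≈ m′ → n ≈ n′ → m ℕ.* n ≈ m′ ℕ.* n′
    *-cong {m} {m′} {n} {n′} e f =
      trans (%-distribˡ-* m n N) (trans (cong₂ (λ i j → (i ℕ.* j) % N) e f) (sym (%-distribˡ-* m′ n′ N)))

    +-cancelʳ : ∀ {m n} k → m ℕ.+ k ≈ n ℕ.+ k → m ≈ n
    +-cancelʳ {m} {n} k e = begin
      m                    ≡⟨ sym (ℕₚ.+-identityʳ m) ⟩
      m ℕ.+ 0              ≈⟨ +-cong {m} refl (sym k+k′≈0) ⟩
      m ℕ.+ (k ℕ.+ k′)     ≡⟨ sym (ℕₚ.+-assoc m k k′) ⟩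
      m ℕ.+ k ℕ.+ k′       ≈⟨ +-cong e refl ⟩
      n ℕ.+ k ℕ.+ k′       ≡⟨ ℕₚ.+-assoc n k k′ ⟩
      n ℕ.+ (k ℕ.+ k′)     ≈⟨ +-cong {n} refl k+k′≈0 ⟩
      n ℕ.+ 0              ≡⟨ ℕₚ.+-identityʳ n ⟩
      n                    ∎
      where
      k′ = N ∸ k % N
      k+k′≈0 : k ℕ.+ k′ ≈ 0
      k+k′≈0 = begin
        k ℕ.+ k′       ≈⟨ +-cong (sym (m%n%n≡m%n k N)) refl ⟩
        k % N ℕ.+ k′   ≡⟨ ℕₚ.m+[n∸m]≡n (ℕₚ.<⇒≤ (m%n<n k N)) ⟩
        N              ≈⟨ N≈0 ⟩
        0              ∎

    -N-inverseˡ : ∀ a → toℕ (-N_ N a) ℕ.+ toℕ a ≈ 0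
    -N-inverseˡ a = begin
      toℕ (-N_ N a) ℕ.+ toℕ a  ≈⟨ +-cong (toℕ-mod (N ∸ toℕ a)) refl ⟩
      N ∸ toℕ a ℕ.+ toℕ a      ≡⟨ ℕₚ.m∸n+n≡m (ℕₚ.<⇒≤ (toℕ<n a)) ⟩
      N                        ≈⟨ N≈0 ⟩
      0                        ∎

  *N-comm : ∀ a b → _*N_ N a b ≡ _*N_ N b a
  *N-comm a b = cong (_mod N) (ℕₚ.*-comm (toℕ a) (toℕ b))

  *N-assoc : ∀ a b c → _*N_ N (_*N_ N a b) c ≡ _*N_ N a (_*N_ N b c)
  *N-assoc a b c = ≈⇒≡ (begin
    toℕ (_*N_ N (_*N_ N a b) c)       ≈⟨ toℕ-mod _ ⟩
    toℕ (_*N_ N a b) ℕ.* toℕ c        ≈⟨ *-cong (toℕ-mod (toℕ a ℕ.* toℕ b)) refl ⟩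
    toℕ a ℕ.* toℕ b ℕ.* toℕ c         ≡⟨ ℕₚ.*-assoc (toℕ a) (toℕ b) (toℕ c) ⟩
    toℕ a ℕ.* (toℕ b ℕ.* toℕ c)       ≈⟨ *-cong {toℕ a} refl (sym (toℕ-mod (toℕ b ℕ.* toℕ c))) ⟩
    toℕ a ℕ.* toℕ (_*N_ N b c)        ≈⟨ sym (toℕ-mod _) ⟩
    toℕ (_*N_ N a (_*N_ N b c))       ∎)

  *N-identityˡ : ∀ a → _*N_ N (1N N) a ≡ a
  *N-identityˡ a = ≈⇒≡ (begin
    toℕ (_*N_ N (1N N) a)     ≈⟨ toℕ-mod _ ⟩
    toℕ (1N N) ℕ.* toℕ a      ≈⟨ *-cong (toℕ-mod 1) refl ⟩
    1 ℕ.* toℕ a               ≡⟨ ℕₚ.*-identityˡ (toℕ a) ⟩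
    toℕ a                     ∎)

  *N-zeroʳ : ∀ a → _*N_ N a (0N N) ≡ 0N N
  *N-zeroʳ a = ≈⇒≡ (begin
    toℕ (_*N_ N a (0N N))     ≈⟨ toℕ-mod _ ⟩
    toℕ a ℕ.* toℕ (0N N)      ≈⟨ *-cong {toℕ a} refl (toℕ-mod 0) ⟩
    toℕ a ℕ.* 0               ≡⟨ ℕₚ.*-zeroʳ (toℕ a) ⟩
    0                         ≈⟨ sym (toℕ-mod 0) ⟩
    toℕ (0N N)                ∎)

  *N-distribˡ-+N : ∀ a b c → _*N_ N a (_+N_ N b c) ≡ _+N_ N (_*N_ N a b) (_*N_ N a c)
  *N-distribˡ-+N a b c = ≈⇒≡ (begin
    toℕ (_*N_ N a (_+N_ N b c))               ≈⟨ toℕ-mod _ ⟩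
    toℕ a ℕ.* toℕ (_+N_ N b c)                ≈⟨ *-cong {toℕ a} refl (toℕ-mod _) ⟩
    toℕ a ℕ.* (toℕ b ℕ.+ toℕ c)               ≡⟨ ℕₚ.*-distribˡ-+ (toℕ a) (toℕ b) (toℕ c) ⟩
    toℕ a ℕ.* toℕ b ℕ.+ toℕ a ℕ.* toℕ c       ≈⟨ sym (+-cong (toℕ-mod _) (toℕ-mod _)) ⟩
    toℕ (_*N_ N a b) ℕ.+ toℕ (_*N_ N a c)     ≈⟨ sym (toℕ-mod _) ⟩
    toℕ (_+N_ N (_*N_ N a b) (_*N_ N a c))    ∎)

  *N-negʳ : ∀ a b → _*N_ N a (-N_ N b) ≡ -N_ N (_*N_ N a b)
  *N-negʳ a b = ≈⇒≡ (+-cancelʳ (toℕ (_*N_ N a b)) (begin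
    toℕ (_*N_ N a (-N_ N b)) ℕ.+ toℕ (_*N_ N a b)   ≈⟨ +-cong (toℕ-mod _) (toℕ-mod _) ⟩
    toℕ a ℕ.* toℕ (-N_ N b) ℕ.+ toℕ a ℕ.* toℕ b     ≡⟨ sym (ℕₚ.*-distribˡ-+ (toℕ a) _ _) ⟩
    toℕ a ℕ.* (toℕ (-N_ N b) ℕ.+ toℕ b)             ≈⟨ *-cong {toℕ a} refl (-N-inverseˡ b) ⟩
    toℕ a ℕ.* 0                                     ≡⟨ ℕₚ.*-zeroʳ (toℕ a) ⟩
    0                                               ≈⟨ sym (-N-inverseˡ (_*N_ N a b)) ⟩
    toℕ (-N_ N (_*N_ N a b)) ℕ.+ toℕ (_*N_ N a b)   ∎))

  *N-distribˡ--N : ∀ a b c → _*N_ N a (_-N_ N b c) ≡ _-N_ N (_*N_ N a b) (_*N_ N a c)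
  *N-distribˡ--N a b c = trans (*N-distribˡ-+N a b (-N_ N c)) (cong (_+N_ N (_*N_ N a b)) (*N-negʳ a c))

  unit-cancelˡ : ∀ {a b} → _*N_ N a b ≡ 1N N → ∀ c → _*N_ N a (_*N_ N b c) ≡ c
  unit-cancelˡ {a} {b} ab≡1 c =
    trans (sym (*N-assoc a b c)) (trans (cong (λ u → _*N_ N u c) ab≡1) (*N-identityˡ c))

open ResidueArithmetic
open ≡-Reasoning

∑ : {B : Set} → List B → (B → ℚ) → ℚ
∑ L F = sumℚ (map F L)

∑-cong : {B : Set} (L : List B) {F G : B → ℚ} → F ≗ G → ∑ L F ≡ ∑ L G
∑-cong L F≗G = cong sumℚ (map-cong F≗G L)

∑-zero : {B : Set} (L : List B) {F : B → ℚ} → (∀ b → F b ≡ 0ℚ) → ∑ L F ≡ 0ℚ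
∑-zero []      F≡0 = refl
∑-zero (b ∷ L) F≡0 = trans (cong₂ _+_ (F≡0 b) (∑-zero L F≡0)) (+-identityʳ 0ℚ)

∑-++ : {B : Set} (L M : List B) (F : B → ℚ) → ∑ (L ++ M) F ≡ ∑ L F + ∑ M F
∑-++ []      M F = sym (+-identityˡ (∑ M F))
∑-++ (b ∷ L) M F = trans (cong (F b +_) (∑-++ L M F)) (sym (+-assoc (F b) (∑ L F) (∑ M F)))

module _ {B C : Set} where

  ∑-map : (k : C → B) (L : List C) (F : B → ℚ) → ∑ (map k L) F ≡ ∑ L (F ∘ k)
  ∑-map k L F = cong sumℚ (sym (map-∘ L))

  ∑-concatMap : (k : C → List B) (L : List C) (F : B → ℚ) →
                ∑ (concatMap k L) F ≡ ∑ L (λ c → ∑ (k c) F)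
  ∑-concatMap k []      F = refl
  ∑-concatMap k (c ∷ L) F = trans (∑-++ (k c) (concatMap k L) F) (cong (∑ (k c) F +_) (∑-concatMap k L F))

∑-concatMap-map : {B C D : Set} (k : C → D → B) (L : List C) (M : List D) (F : B → ℚ) →
                  ∑ (concatMap (λ c → map (k c) M) L) F ≡ ∑ L (λ c → ∑ M (F ∘ k c))
∑-concatMap-map k L M F = trans (∑-concatMap _ L F) (∑-cong L (λ c → ∑-map (k c) M F))

∑-allFin : ∀ {n} (F : Fin n → ℚ) → ∑ (allFin n) F ≡ sum F
∑-allFin F = trans (cong sumℚ (map-tabulate id F)) (sumℚ-tabulate F)
  where
  sumℚ-tabulate : ∀ {n} (F : Fin n → ℚ) → sumℚ (tabulate F) ≡ sum F
  sumℚ-tabulate {zero}  F = refl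
  sumℚ-tabulate {suc n} F = cong (F Fin.zero +_) (sumℚ-tabulate (F ∘ Fin.suc))

∑-allFin-permute : ∀ {n} (σ τ : Fin n → Fin n) → (∀ i → σ (τ i) ≡ i) → (∀ i → τ (σ i) ≡ i) →
                   (F : Fin n → ℚ) → ∑ (allFin n) F ≡ ∑ (allFin n) (F ∘ σ)
∑-allFin-permute σ τ στ τσ F = begin
  ∑ (allFin _) F        ≡⟨ ∑-allFin F ⟩
  sum F                 ≡⟨ sum-permute F (permutation σ τ στ τσ) ⟩
  sum (F ∘ σ)           ≡⟨ sym (∑-allFin (F ∘ σ)) ⟩
  ∑ (allFin _) (F ∘ σ)  ∎

∑-allFin-select : ∀ {n} (i : Fin n) (F : Fin n → ℚ) → (∀ j → j ≢ i → F j ≡ 0ℚ) → ∑ (allFin n) F ≡ F i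
∑-allFin-select {suc n} i F F≡0 = begin
  ∑ (allFin (suc n)) F         ≡⟨ ∑-allFin F ⟩
  sum F                        ≡⟨ sum-remove {i = i} F ⟩
  F i + sum (F ∘ punchIn i)    ≡⟨ cong (F i +_) (sum-cong-≗ (λ j → F≡0 (punchIn i j) (punchInᵢ≢i i j))) ⟩
  F i + sum {n} (λ _ → 0ℚ)     ≡⟨ cong (F i +_) (sum-replicate-zero n) ⟩
  F i + 0ℚ                     ≡⟨ +-identityʳ (F i) ⟩
  F i                          ∎

does-⇔ : {A B : Set} → (A → B) → (B → A) → (a? : Dec A) (b? : Dec B) → does a? ≡ does b?
does-⇔ to from a? b? = does-≡ (map′ to from a?) b?

module _ {B : Set} (_≟_ : DecidableEquality B) where

  δ-refl : ∀ a → δ[ _≟_ ≟ a ] a ≡ 1ℚ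
  δ-refl a = cong (if_then 1ℚ else 0ℚ) (dec-true (a ≟ a) refl)

  δ-≢ : ∀ {a b} → a ≢ b → δ[ _≟_ ≟ a ] b ≡ 0ℚ
  δ-≢ {a} {b} a≢b = cong (if_then 1ℚ else 0ℚ) (dec-false (a ≟ b) a≢b)

  δ-cong : ∀ {B′} (_≟′_ : DecidableEquality B′) {a b a′ b′} →
           (a ≡ b → a′ ≡ b′) → (a′ ≡ b′ → a ≡ b) → δ[ _≟_ ≟ a ] b ≡ δ[ _≟′_ ≟ a′ ] b′
  δ-cong _≟′_ {a} {b} {a′} {b′} to from = cong (if_then 1ℚ else 0ℚ) (does-⇔ to from (a ≟ b) (a′ ≟′ b′))

map-inverse : {B : Set} {f g : B → B} → (∀ b → f (g b) ≡ b) → ∀ w → map f (map g w) ≡ w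
map-inverse f∘g w = trans (sym (map-∘ w)) (trans (map-cong f∘g w) (map-id w))

map⊗ : {A : Set} → (A → A) → Word A × Word A → Word A × Word A
map⊗ h = Product.map (map h) (map h)

module RelabelPrimitive {A : Set} (_≟_ : DecidableEquality A)
                        (Δl : A → List (Word A × Word A))
                        (cands : Word A → Word A → List (Word A))
                        {f g : A → A} (f∘g : ∀ a → f (g a) ≡ a) (g∘f : ∀ a → g (f a) ≡ a) where

  open Coproduct _≟_ Δl cands

  ∑-Δw-∷ : ∀ a w H → ∑ (Δw (a ∷ w)) H ≡
           ∑ (Δl a) (λ (p , q) → ∑ (Δw w) (λ (u , v) → H (p ++ u , q ++ v)))
  ∑-Δw-∷ a w H = trans (∑-concatMap _ (Δl a) H)
    (∑-cong (Δl a) λ { (p , q) → trans (∑-map _ (Δw w) H) (∑-cong (Δw w) λ { (u , v) → refl }) })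

  module _ (Δl-relabel : ∀ a H → ∑ (Δl (g a)) H ≡ ∑ (Δl a) (H ∘ map⊗ g)) where

    ∑-Δw-relabel : ∀ w H → ∑ (Δw (map g w)) H ≡ ∑ (Δw w) (H ∘ map⊗ g)
    ∑-Δw-relabel []      H = refl
    ∑-Δw-relabel (a ∷ w) H = begin
      ∑ (Δw (g a ∷ map g w)) H
        ≡⟨ ∑-Δw-∷ (g a) (map g w) H ⟩
      ∑ (Δl (g a)) (λ (p , q) → ∑ (Δw (map g w)) (λ (u , v) → H (p ++ u , q ++ v)))
        ≡⟨ ∑-cong (Δl (g a)) (λ (p , q) → ∑-Δw-relabel w _) ⟩
      ∑ (Δl (g a)) (λ (p , q) → ∑ (Δw w) (λ (u , v) → H (p ++ map g u , q ++ map g v)))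
        ≡⟨ Δl-relabel a _ ⟩
      ∑ (Δl a) (λ (p , q) → ∑ (Δw w) (λ (u , v) → H (map g p ++ map g u , map g q ++ map g v)))
        ≡⟨ ∑-cong (Δl a) (λ (p , q) → ∑-cong (Δw w) (λ (u , v) →
             cong₂ (λ s t → H (s , t)) (sym (map-++ g p u)) (sym (map-++ g q v)))) ⟩
      ∑ (Δl a) (λ (p , q) → ∑ (Δw w) (λ (u , v) → H (map⊗ g (p ++ u , q ++ v))))
        ≡⟨ sym (∑-Δw-∷ a w (H ∘ map⊗ g)) ⟩
      ∑ (Δw (a ∷ w)) (H ∘ map⊗ g) ∎

    Δcoeff-relabel : ∀ w u v → Δcoeff (map g w) u v ≡ Δcoeff w (map f u) (map f v)
    Δcoeff-relabel w u v = trans (∑-Δw-relabel w _) (∑-cong (Δw w) λ (p , q) →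
      δ-cong _≟p_ _≟p_ {u , v} {map⊗ g (p , q)} {map f u , map f v} {p , q}
        (λ e → cong₂ _,_ (trans (cong (map f ∘ Product.proj₁) e) (map-inverse f∘g p))
                         (trans (cong (map f ∘ Product.proj₂) e) (map-inverse f∘g q)))
        (λ e → cong₂ _,_ (trans (sym (map-inverse g∘f u)) (cong (map g ∘ Product.proj₁) e))
                         (trans (sym (map-inverse g∘f v)) (cong (map g ∘ Product.proj₂) e))))

    IsPrimitive-relabel : (∀ u v K → ∑ (cands u v) K ≡ ∑ (cands u v) (K ∘ map g)) →
                          (∀ u v → cands (map f u) (map f v) ≡ cands u v) →
                          ∀ {ψ φ} → (∀ w → φ w ≡ ψ (map f w)) → IsPrimitive ψ → IsPrimitive φ
    IsPrimitive-relabel ∑-cands-relabel cands-relabel {ψ} {φ} φ≡ψ∘f ψ-prim u v = begin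
      Δ φ u v
        ≡⟨ ∑-cong (cands u v) (λ w → cong (_* Δcoeff w u v) (φ≡ψ∘f w)) ⟩
      ∑ (cands u v) (λ w → ψ (map f w) * Δcoeff w u v)
        ≡⟨ ∑-cands-relabel u v _ ⟩
      ∑ (cands u v) (λ w → ψ (map f (map g w)) * Δcoeff (map g w) u v)
        ≡⟨ ∑-cong (cands u v) (λ w → cong₂ _*_ (cong ψ (map-inverse f∘g w)) (Δcoeff-relabel w u v)) ⟩
      ∑ (cands u v) (λ w → ψ w * Δcoeff w (map f u) (map f v))
        ≡⟨ cong (λ L → ∑ L (λ w → ψ w * Δcoeff w (map f u) (map f v))) (sym (cands-relabel u v)) ⟩
      Δ ψ (map f u) (map f v)
        ≡⟨ ψ-prim (map f u) (map f v) ⟩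
      prim ψ (map f u) (map f v)
        ≡⟨ cong₂ _+_ (cong₂ _*_ (δ[]-relabel v) (sym (φ≡ψ∘f u))) (cong₂ _*_ (δ[]-relabel u) (sym (φ≡ψ∘f v))) ⟩
      prim φ u v ∎
      where
      δ[]-relabel : ∀ w → δ[ _≟w_ ≟ [] ] (map f w) ≡ δ[ _≟w_ ≟ [] ] w
      δ[]-relabel w = δ-cong _≟w_ _≟w_ {[]} {map f w} {[]} {w}
        (λ e → trans (cong (map g) e) (map-inverse g∘f w)) (cong (map f))

module _ {N : ℕ} .{{_ : NonZero N}} where

  letters : List (XLetter N)
  letters = x₀ ∷ map x (allFin N)

  relabelY : ZN N → YLetter N → YLetter N
  relabelY g y[1+ j , a ] = y[1+ j , _*N_ N g a ]

  _≟XW_ : DecidableEquality (Word (XLetter N))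
  _≟XW_ = ≡-dec _≟X_

  ∑-letters-select : ∀ l (H : XLetter N → ℚ) → (∀ l′ → l′ ≢ l → H l′ ≡ 0ℚ) → ∑ letters H ≡ H l
  ∑-letters-select x₀ H H≡0 = begin
    H x₀ + ∑ (map x (allFin N)) H   ≡⟨ cong (H x₀ +_) (∑-map x (allFin N) H) ⟩
    H x₀ + ∑ (allFin N) (H ∘ x)     ≡⟨ cong (H x₀ +_) (∑-zero (allFin N) (λ a → H≡0 (x a) λ ())) ⟩
    H x₀ + 0ℚ                       ≡⟨ +-identityʳ (H x₀) ⟩
    H x₀                            ∎
  ∑-letters-select (x a) H H≡0 = begin
    H x₀ + ∑ (map x (allFin N)) H   ≡⟨ cong₂ _+_ (H≡0 x₀ λ ()) (∑-map x (allFin N) H) ⟩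
    0ℚ + ∑ (allFin N) (H ∘ x)       ≡⟨ +-identityˡ _ ⟩
    ∑ (allFin N) (H ∘ x)            ≡⟨ ∑-allFin-select a (H ∘ x) (λ b b≢a → H≡0 (x b) λ { refl → b≢a refl }) ⟩
    H (x a)                         ∎

  ∑-wordsX-suc : ∀ n (K : Word (XLetter N) → ℚ) →
                 ∑ (wordsX N (suc n)) K ≡ ∑ letters (λ l → ∑ (wordsX N n) (K ∘ (l ∷_)))
  ∑-wordsX-suc n = ∑-concatMap-map _∷_ letters (wordsX N n)

  ∑-wordsX-δ : ∀ v (K : Word (XLetter N) → ℚ) → ∑ (wordsX N (length v)) (λ w → K w * δ[ _≟XW_ ≟ v ] w) ≡ K v
  ∑-wordsX-δ [] K = begin
    K [] * δ[ _≟XW_ ≟ [] ] [] + 0ℚ  ≡⟨ +-identityʳ _ ⟩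
    K [] * δ[ _≟XW_ ≟ [] ] []       ≡⟨ cong (K [] *_) (δ-refl _≟XW_ []) ⟩
    K [] * 1ℚ                       ≡⟨ *-identityʳ (K []) ⟩
    K []                            ∎
  ∑-wordsX-δ (l ∷ v) K = begin
    ∑ (wordsX N (suc (length v))) (λ w → K w * δ[ _≟XW_ ≟ l ∷ v ] w)
      ≡⟨ ∑-wordsX-suc (length v) _ ⟩
    ∑ letters (λ l′ → ∑ (wordsX N (length v)) (λ w → K (l′ ∷ w) * δ[ _≟XW_ ≟ l ∷ v ] (l′ ∷ w)))
      ≡⟨ ∑-letters-select l _ (λ l′ l′≢l → ∑-zero (wordsX N (length v)) (λ w →
           trans (cong (K (l′ ∷ w) *_) (δ-≢ _≟XW_ {l ∷ v} {l′ ∷ w} λ { refl → l′≢l refl }))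
                 (*-zeroʳ (K (l′ ∷ w))))) ⟩
    ∑ (wordsX N (length v)) (λ w → K (l ∷ w) * δ[ _≟XW_ ≟ l ∷ v ] (l ∷ w))
      ≡⟨ ∑-cong (wordsX N (length v)) (λ w → cong (K (l ∷ w) *_)
           (δ-cong _≟XW_ _≟XW_ {l ∷ v} {l ∷ w} {v} {w} (λ { refl → refl }) (λ { refl → refl }))) ⟩
    ∑ (wordsX N (length v)) (λ w → K (l ∷ w) * δ[ _≟XW_ ≟ v ] w)
      ≡⟨ ∑-wordsX-δ v (K ∘ (l ∷_)) ⟩
    K (l ∷ v) ∎

  ∑-wordsYfuel-suc : ∀ f n (K : Word (YLetter N) → ℚ) → ∑ (wordsYfuel N (suc f) (suc n)) K ≡
    ∑ (allFin (suc n)) (λ j → ∑ (allFin N) (λ a → ∑ (wordsYfuel N f (n ∸ toℕ j)) (K ∘ (y[1+ toℕ j , a ] ∷_))))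
  ∑-wordsYfuel-suc f n K = trans (∑-concatMap wordsStartingWith (allFin (suc n)) K) (∑-cong (allFin (suc n)) (λ j →
    ∑-concatMap-map (λ a → y[1+ toℕ j , a ] ∷_) (allFin N) (wordsYfuel N f (n ∸ toℕ j)) K))
    where
    wordsStartingWith : Fin (suc n) → List (Word (YLetter N))
    wordsStartingWith j = concatMap (λ a → map (y[1+ toℕ j , a ] ∷_) (wordsYfuel N f (n ∸ toℕ j))) (allFin N)

  module MultiplicationByUnit {g h : ZN N} (gh≡1 : _*N_ N g h ≡ 1N N) where

    private
      hg≡1 : _*N_ N h g ≡ 1N N
      hg≡1 = trans (*N-comm h g) gh≡1

    δLetter-cancelˡ : ∀ l → δLetter N g (δLetter N h l) ≡ l
    δLetter-cancelˡ x₀    = refl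
    δLetter-cancelˡ (x a) = cong x (unit-cancelˡ {a = g} {b = h} gh≡1 a)

    relabelY-cancelˡ : ∀ l → relabelY g (relabelY h l) ≡ l
    relabelY-cancelˡ y[1+ j , a ] = cong y[1+ j ,_] (unit-cancelˡ {a = g} {b = h} gh≡1 a)

    ∑-allFin-unit : (F : ZN N → ℚ) → ∑ (allFin N) F ≡ ∑ (allFin N) (λ a → F (_*N_ N g a))
    ∑-allFin-unit = ∑-allFin-permute (_*N_ N g) (_*N_ N h)
      (unit-cancelˡ {a = g} {b = h} gh≡1) (unit-cancelˡ {a = h} {b = g} hg≡1)

    ∑-letters-unit : (H : XLetter N → ℚ) → ∑ letters H ≡ ∑ letters (H ∘ δLetter N g)
    ∑-letters-unit H = cong (H x₀ +_) (begin
      ∑ (map x (allFin N)) H                   ≡⟨ ∑-map x (allFin N) H ⟩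
      ∑ (allFin N) (H ∘ x)                     ≡⟨ ∑-allFin-unit (H ∘ x) ⟩
      ∑ (allFin N) (H ∘ δLetter N g ∘ x)       ≡⟨ sym (∑-map x (allFin N) (H ∘ δLetter N g)) ⟩
      ∑ (map x (allFin N)) (H ∘ δLetter N g)   ∎)

    ∑-wordsX-unit : ∀ n (K : Word (XLetter N) → ℚ) → ∑ (wordsX N n) K ≡ ∑ (wordsX N n) (K ∘ map (δLetter N g))
    ∑-wordsX-unit zero    K = refl
    ∑-wordsX-unit (suc n) K = begin
      ∑ (wordsX N (suc n)) K
        ≡⟨ ∑-wordsX-suc n K ⟩
      ∑ letters (λ l → ∑ (wordsX N n) (K ∘ (l ∷_)))
        ≡⟨ ∑-letters-unit (λ l → ∑ (wordsX N n) (K ∘ (l ∷_))) ⟩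
      ∑ letters (λ l → ∑ (wordsX N n) (K ∘ (δLetter N g l ∷_)))
        ≡⟨ ∑-cong letters (λ l → ∑-wordsX-unit n _) ⟩
      ∑ letters (λ l → ∑ (wordsX N n) (λ w → K (δLetter N g l ∷ map (δLetter N g) w)))
        ≡⟨ sym (∑-wordsX-suc n _) ⟩
      ∑ (wordsX N (suc n)) (K ∘ map (δLetter N g)) ∎

    ∑-wordsYfuel-unit : ∀ f n (K : Word (YLetter N) → ℚ) →
                        ∑ (wordsYfuel N f n) K ≡ ∑ (wordsYfuel N f n) (K ∘ map (relabelY g))
    ∑-wordsYfuel-unit f       zero    K = refl
    ∑-wordsYfuel-unit zero    (suc n) K = refl
    ∑-wordsYfuel-unit (suc f) (suc n) K = begin
      ∑ (wordsYfuel N (suc f) (suc n)) K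
        ≡⟨ ∑-wordsYfuel-suc f n K ⟩
      ∑ (allFin (suc n)) (λ j → ∑ (allFin N) (λ a → ∑ (wordsYfuel N f (n ∸ toℕ j)) (K ∘ (y[1+ toℕ j , a ] ∷_))))
        ≡⟨ ∑-cong (allFin (suc n)) (λ j → trans (∑-allFin-unit _) (∑-cong (allFin N) (λ a →
             ∑-wordsYfuel-unit f (n ∸ toℕ j) _))) ⟩
      ∑ (allFin (suc n)) (λ j → ∑ (allFin N) (λ a → ∑ (wordsYfuel N f (n ∸ toℕ j))
        (λ w → K (y[1+ toℕ j , _*N_ N g a ] ∷ map (relabelY g) w))))
        ≡⟨ sym (∑-wordsYfuel-suc f n _) ⟩
      ∑ (wordsYfuel N (suc f) (suc n)) (K ∘ map (relabelY g)) ∎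

  module _ (β : ZN N) where

    private
      δβ = δLetter N β

    weight-relabelY : ∀ w → weight (map (relabelY β) w) ≡ weight w
    weight-relabelY []                 = refl
    weight-relabelY (y[1+ j , a ] ∷ w) = cong (suc j ℕ.+_) (weight-relabelY w)

    AllK1-relabelY : ∀ w → AllK1 N (map (relabelY β) w) ≡ AllK1 N w
    AllK1-relabelY []                     = refl
    AllK1-relabelY (y[1+ zero , a ] ∷ w)  = AllK1-relabelY w
    AllK1-relabelY (y[1+ suc j , a ] ∷ w) = refl

    embed-relabel : ∀ w → embed (map (relabelY β) w) ≡ map δβ (embed w)
    embed-relabel []                 = refl
    embed-relabel (y[1+ j , a ] ∷ w) = sym (begin
      map δβ (replicate j x₀ ++ x a ∷ embed w)
        ≡⟨ map-++ δβ (replicate j x₀) (x a ∷ embed w) ⟩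
      map δβ (replicate j x₀) ++ x (_*N_ N β a) ∷ map δβ (embed w)
        ≡⟨ cong₂ (λ u v → u ++ x (_*N_ N β a) ∷ v) (map-replicate δβ j x₀) (sym (embed-relabel w)) ⟩
      replicate j x₀ ++ x (_*N_ N β a) ∷ embed (map (relabelY β) w) ∎)

    pAcc-relabel : ∀ c w → pAcc N (_*N_ N β c) (map δβ w) ≡ map δβ (pAcc N c w)
    pAcc-relabel c []        = refl
    pAcc-relabel c (x₀ ∷ w)  = cong (x₀ ∷_) (pAcc-relabel c w)
    pAcc-relabel c (x a ∷ w) rewrite sym (*N-distribˡ-+N β c a) = cong (x _ ∷_) (pAcc-relabel (_+N_ N c a) w)

    p-relabel : ∀ w → p N (map δβ w) ≡ map δβ (p N w)
    p-relabel w = trans (cong (λ c → pAcc N c (map δβ w)) (sym (*N-zeroʳ β))) (pAcc-relabel (0N N) w)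

    nextα-relabel : ∀ w → nextα N (map δβ w) ≡ _*N_ N β (nextα N w)
    nextα-relabel []        = sym (*N-zeroʳ β)
    nextα-relabel (x₀ ∷ w)  = nextα-relabel w
    nextα-relabel (x a ∷ w) = refl

    q~-relabel : ∀ w → q~ N (map δβ w) ≡ map δβ (q~ N w)
    q~-relabel []        = refl
    q~-relabel (x₀ ∷ w)  = cong (x₀ ∷_) (q~-relabel w)
    q~-relabel (x a ∷ w) = cong₂ (λ b → x b ∷_)
      (trans (cong (_-N_ N (_*N_ N β a)) (nextα-relabel w)) (sym (*N-distribˡ--N β a (nextα N w))))
      (q~-relabel w)

    x₀ⁿxₐ-relabel : ∀ n a → map δβ (replicate n x₀ ++ x a ∷ []) ≡ replicate n x₀ ++ x (_*N_ N β a) ∷ []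
    x₀ⁿxₐ-relabel n a = trans (map-++ δβ (replicate n x₀) (x a ∷ [])) (cong (_++ _) (map-replicate δβ n x₀))

    y₁₀ⁿ-relabel : ∀ n → map (relabelY β) (replicate n y[1+ 0 , 0N N ]) ≡ replicate n y[1+ 0 , 0N N ]
    y₁₀ⁿ-relabel n = trans (map-replicate (relabelY β) n _) (cong (λ a → replicate n y[1+ 0 , a ]) (*N-zeroʳ β))

  module UnitRelabelling {γ β : ZN N} (γβ≡1 : _*N_ N γ β ≡ 1N N) where

    private
      δβ = δLetter N β
      δγ = δLetter N γ
      open MultiplicationByUnit {g = γ} {h = β} γβ≡1
        renaming (∑-allFin-unit to ∑-allFin-*γ; δLetter-cancelˡ to δγ∘δβ; relabelY-cancelˡ to relabelYγ∘β)
      open MultiplicationByUnit {g = β} {h = γ} (trans (*N-comm β γ) γβ≡1)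
        using () renaming (∑-allFin-unit to ∑-allFin-*β; δLetter-cancelˡ to δβ∘δγ; relabelY-cancelˡ to relabelYβ∘γ)

    δ-coeff : ∀ ψ v → δ N γ ψ v ≡ ψ (map δβ v)
    δ-coeff ψ v = begin
      ∑ (wordsX N (length v)) (λ w → ψ w * δ[ _≟XW_ ≟ v ] (map δγ w))
        ≡⟨ ∑-cong (wordsX N (length v)) (λ w → cong (ψ w *_) (δ-cong _≟XW_ _≟XW_ {v} {map δγ w} {map δβ v} {w}
             (λ v≡γw → trans (cong (map δβ) v≡γw) (map-inverse δβ∘δγ w))
             (λ βv≡w → trans (sym (map-inverse δγ∘δβ v)) (cong (map δγ) βv≡w)))) ⟩
      ∑ (wordsX N (length v)) (λ w → ψ w * δ[ _≟XW_ ≟ map δβ v ] w)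
        ≡⟨ cong (λ n → ∑ (wordsX N n) (λ w → ψ w * δ[ _≟XW_ ≟ map δβ v ] w)) (sym (length-map δβ v)) ⟩
      ∑ (wordsX N (length (map δβ v))) (λ w → ψ w * δ[ _≟XW_ ≟ map δβ v ] w)
        ≡⟨ ∑-wordsX-δ (map δβ v) ψ ⟩
      ψ (map δβ v) ∎

    Δl-st~-relabel : ∀ a (H : Word (YLetter N) × Word (YLetter N) → ℚ) →
                     ∑ (Δl-st~ N (relabelY γ a)) H ≡ ∑ (Δl-st~ N a) (H ∘ map⊗ (relabelY γ))
    Δl-st~-relabel y[1+ zero , a ]  H = refl
    Δl-st~-relabel y[1+ suc m , a ] H = cong (λ s → H _ + (H _ + s))
      (trans (∑-map _ (allFin (suc m)) H) (sym (∑-map _ (allFin (suc m)) (H ∘ map⊗ (relabelY γ)))))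

    Δl-st-relabel : ∀ a (H : Word (YLetter N) × Word (YLetter N) → ℚ) →
                    ∑ (Δl-st N (relabelY γ a)) H ≡ ∑ (Δl-st N a) (H ∘ map⊗ (relabelY γ))
    Δl-st-relabel y[1+ zero , a ]  H = refl
    Δl-st-relabel y[1+ suc m , a ] H = cong (λ s → H _ + (H _ + s)) (begin
      ∑ (concatMap (λ j → map (split j) (allFin N)) (allFin (suc m))) H
        ≡⟨ ∑-concatMap-map split (allFin (suc m)) (allFin N) H ⟩
      ∑ (allFin (suc m)) (λ j → ∑ (allFin N) (λ b → H (y (toℕ j) b , y (m ∸ toℕ j) (γ ⊛ a ⊝ b))))
        ≡⟨ ∑-cong (allFin (suc m)) (λ j → ∑-allFin-*γ _) ⟩
      ∑ (allFin (suc m)) (λ j → ∑ (allFin N) (λ b → H (y (toℕ j) (γ ⊛ b) , y (m ∸ toℕ j) (γ ⊛ a ⊝ γ ⊛ b))))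
        ≡⟨ ∑-cong (allFin (suc m)) (λ j → ∑-cong (allFin N) (λ b →
             cong (λ c → H (y (toℕ j) (γ ⊛ b) , y (m ∸ toℕ j) c)) (sym (*N-distribˡ--N γ a b)))) ⟩
      ∑ (allFin (suc m)) (λ j → ∑ (allFin N) (λ b → H (y (toℕ j) (γ ⊛ b) , y (m ∸ toℕ j) (γ ⊛ (a ⊝ b)))))
        ≡⟨ sym (∑-concatMap-map split′ (allFin (suc m)) (allFin N) (H ∘ map⊗ (relabelY γ))) ⟩
      ∑ (concatMap (λ j → map (split′ j) (allFin N)) (allFin (suc m))) (H ∘ map⊗ (relabelY γ)) ∎)
      where
      infixl 7 _⊛_
      infixl 6 _⊝_
      _⊛_ = _*N_ N
      _⊝_ = _-N_ N
      y : ℕ → ZN N → Word (YLetter N)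
      y k b = y[1+ k , b ] ∷ []
      split split′ : Fin (suc m) → ZN N → Word (YLetter N) × Word (YLetter N)
      split  j b = y (toℕ j) b , y (m ∸ toℕ j) (γ ⊛ a ⊝ b)
      split′ j b = y (toℕ j) b , y (m ∸ toℕ j) (a ⊝ b)

    private
      module RelabelY Δl = RelabelPrimitive _≟Y_ Δl (λ u v → wordsY N (weight u ℕ.+ weight v))
                             {f = relabelY β} {g = relabelY γ} relabelYβ∘γ relabelYγ∘β

      ∑-wordsY-unit : ∀ (u v : Word (YLetter N)) K → ∑ (wordsY N (weight u ℕ.+ weight v)) K ≡
                      ∑ (wordsY N (weight u ℕ.+ weight v)) (K ∘ map (relabelY γ))
      ∑-wordsY-unit u v = ∑-wordsYfuel-unit (weight u ℕ.+ weight v) (weight u ℕ.+ weight v)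

      wordsY-relabel : ∀ (u v : Word (YLetter N)) →
                       wordsY N (weight (map (relabelY β) u) ℕ.+ weight (map (relabelY β) v)) ≡ wordsY N (weight u ℕ.+ weight v)
      wordsY-relabel u v = cong (wordsY N) (cong₂ ℕ._+_ (weight-relabelY β u) (weight-relabelY β v))

    IsShPrimitive-relabel : ∀ {ψ φ} → (∀ w → φ w ≡ ψ (map δβ w)) → IsShPrimitive N ψ → IsShPrimitive N φ
    IsShPrimitive-relabel =
      RelabelPrimitive.IsPrimitive-relabel _≟X_ Δl-sh (λ u v → wordsX N (length u ℕ.+ length v))
        {f = δβ} {g = δγ} δβ∘δγ δγ∘δβ
        (λ a H → refl) (λ u v → ∑-wordsX-unit (length u ℕ.+ length v))
        (λ u v → cong (wordsX N) (cong₂ ℕ._+_ (length-map δβ u) (length-map δβ v)))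

    IsStPrimitive-relabel : ∀ {ψ φ} → (∀ w → φ w ≡ ψ (map (relabelY β) w)) → IsStPrimitive N ψ → IsStPrimitive N φ
    IsStPrimitive-relabel = RelabelY.IsPrimitive-relabel (Δl-st N) Δl-st-relabel ∑-wordsY-unit wordsY-relabel

    IsSt~Primitive-relabel : ∀ {ψ φ} → (∀ w → φ w ≡ ψ (map (relabelY β) w)) → IsSt~Primitive N ψ → IsSt~Primitive N φ
    IsSt~Primitive-relabel = RelabelY.IsPrimitive-relabel (Δl-st~ N) Δl-st~-relabel ∑-wordsY-unit wordsY-relabel

    module _ {ψ φ : Series (XLetter N)} (φ≡ψ∘δβ : ∀ w → φ w ≡ ψ (map δβ w)) where

      corr-relabel : ∀ w → corr N φ w ≡ corr N ψ (map (relabelY β) w)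
      corr-relabel w rewrite length-map (relabelY β) w with length w
      ... | zero            = refl
      ... | suc zero        = refl
      ... | n@(suc (suc m)) = cong₂ (λ b q → if b then c N n * q else 0ℚ)
        (does-⇔ (λ w≡y₁₀ⁿ → trans (cong (map (relabelY β)) w≡y₁₀ⁿ) (y₁₀ⁿ-relabel β n))
                (λ βw≡y₁₀ⁿ → trans (sym (map-inverse relabelYγ∘β w))
                                   (trans (cong (map (relabelY γ)) βw≡y₁₀ⁿ) (y₁₀ⁿ-relabel γ n)))
                (_≟YW_ N w _) (_≟YW_ N (map (relabelY β) w) _))
        (trans (φ≡ψ∘δβ _) (cong ψ (trans (x₀ⁿxₐ-relabel β (suc m) (0N N))
                                         (cong (λ a → replicate (suc m) x₀ ++ x a ∷ []) (*N-zeroʳ β)))))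

      corr~-relabel : ∀ w → corr~ N φ w ≡ corr~ N ψ (map (relabelY β) w)
      corr~-relabel w rewrite length-map (relabelY β) w with length w
      ... | zero            = refl
      ... | suc zero        = refl
      ... | n@(suc (suc m)) = cong₂ (λ b s → if b then c N n * powℚ N (ℤ.+ 1 / N) (suc n) * s else 0ℚ)
        (sym (AllK1-relabelY β w)) (begin
          ∑ (allFin N) (λ a → φ (replicate (suc m) x₀ ++ x a ∷ []))
            ≡⟨ ∑-cong (allFin N) (λ a → trans (φ≡ψ∘δβ _) (cong ψ (x₀ⁿxₐ-relabel β (suc m) a))) ⟩
          ∑ (allFin N) (λ a → ψ (replicate (suc m) x₀ ++ x (_*N_ N β a) ∷ []))
            ≡⟨ sym (∑-allFin-*β _) ⟩
          ∑ (allFin N) (λ a → ψ (replicate (suc m) x₀ ++ x a ∷ [])) ∎)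

      πY-relabel : ∀ (r : Word (XLetter N) → Word (XLetter N)) → (∀ w → r (map δβ w) ≡ map δβ (r w)) →
                   ∀ w → φ (r (embed w)) ≡ ψ (r (embed (map (relabelY β) w)))
      πY-relabel r r-relabel w =
        trans (φ≡ψ∘δβ _) (cong ψ (sym (trans (cong r (embed-relabel β w)) (r-relabel (embed w)))))

      ψ*-relabel : ∀ w → ψ* N φ w ≡ ψ* N ψ (map (relabelY β) w)
      ψ*-relabel w = cong₂ _+_ (πY-relabel (p N) (p-relabel β) w) (corr-relabel w)

      ψ~*-relabel : ∀ w → ψ~* N φ w ≡ ψ~* N ψ (map (relabelY β) w)
      ψ~*-relabel w = cong₂ _+_ (πY-relabel (q~ N) (q~-relabel β) w) (corr~-relabel w)

      symm-relabel : (∀ a → ψ (x a ∷ []) ≡ ψ (x (-N_ N a) ∷ [])) → ∀ a → φ (x a ∷ []) ≡ φ (x (-N_ N a) ∷ [])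
      symm-relabel ψ-symm a = begin
        φ (x a ∷ [])                        ≡⟨ φ≡ψ∘δβ _ ⟩
        ψ (x (_*N_ N β a) ∷ [])             ≡⟨ ψ-symm _ ⟩
        ψ (x (-N_ N (_*N_ N β a)) ∷ [])     ≡⟨ cong (λ b → ψ (x b ∷ [])) (sym (*N-negʳ β a)) ⟩
        ψ (x (_*N_ N β (-N_ N a)) ∷ [])     ≡⟨ sym (φ≡ψ∘δβ _) ⟩
        φ (x (-N_ N a) ∷ [])                ∎

      InDmr0N-relabel : InDmr0N N ψ → InDmr0N N φ
      InDmr0N-relabel ψ∈ = record
        { coeff-x~ = trans (φ≡ψ∘δβ _) coeff-x~
        ; coeff-Σ  = trans (∑-cong (allFin N) (λ a → φ≡ψ∘δβ (x a ∷ []))) (trans (sym (∑-allFin-*β _)) coeff-Σ)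
        ; sh-prim  = IsShPrimitive-relabel φ≡ψ∘δβ sh-prim
        ; symm     = symm-relabel symm
        ; st-prim  = IsSt~Primitive-relabel ψ~*-relabel st-prim
        }
        where open InDmr0N ψ∈

      InDmr0μ-relabel : InDmr0μ N ψ → InDmr0μ N φ
      InDmr0μ-relabel ψ∈ = record
        { coeff-x₀ = trans (φ≡ψ∘δβ _) coeff-x₀
        ; coeff-x₁ = trans (φ≡ψ∘δβ _) (trans (cong (λ a → ψ (x a ∷ [])) (*N-zeroʳ β)) coeff-x₁)
        ; sh-prim  = IsShPrimitive-relabel φ≡ψ∘δβ sh-prim
        ; symm     = symm-relabel symm
        ; st-prim  = IsStPrimitive-relabel ψ*-relabel st-prim
        }
        where open InDmr0μ ψ∈

proposition3p14 : (N : ℕ) .{{_ : NonZero N}} → 3 ≤ N →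
    (γ : ZN N) → IsUnit N γ →
    (∀ ψ → InDmr0N N ψ → InDmr0N N (δ N γ ψ)) ×
    (∀ ψ → InDmr0μ N ψ → InDmr0μ N (δ N γ ψ))
proposition3p14 N _ γ (β , γβ≡1) =
  (λ ψ → InDmr0N-relabel (δ-coeff ψ)) , (λ ψ → InDmr0μ-relabel (δ-coeff ψ))
  where open UnitRelabelling {γ = γ} {β = β} γβ≡1
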